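{- Let $g,n\in\mathbb{N}$ with $g>3$ and $2\le n\le g$, and let $\mathcal{F}'_{g,n}$ be the set of leaves of the tree $\mathcal{T}'_{g,n}$. If every $S\in\mathcal{F}'_{g,n}$ satisfies Wilf's inequality, then every numerical semigroup in $\mathcal{N}_{g,n}$ satisfies Wilf's inequality.
   Context: $\mathbb{N}=\{0,1,2,\ldots\}$. A numerical semigroup is a submonoid $S$ of $(\mathbb{N},+)$ with $\mathbb{N}\setminus S$ finite. $\operatorname{H}(S)=\mathbb{N}\setminus S$; $\operatorname{g}(S)=|\operatorname{H}(S)|$; $\operatorname{F}(S)=\max\operatorname{H}(S)$; $\operatorname{m}(S)=\min(S\setminus\{0\})$; $\operatorname{n}(S)=|\{s\in S\mid s<\operatorname{F}(S)\}|$; $\operatorname{e}(S)$ is the number of minimal generators of $S$. $S$ satisfies Wilf's inequality if $\operatorname{e}(S)\operatorname{n}(S)\ge\operatorname{F}(S)+1$. $S$ is ordinary if $S=\{0\}\cup\{x\in\mathbb{N}\mid x\ge c\}$ for some $c$; $S$ is almost-ordinary if $S=\{0\}\cup\{g,\ldots,g+n-2\}\cup\{x\in\mathbb{N}\mid x\ge g+n\}$ for some integers $g>2$, $n\in[2,g]$. For non ordinary $S$, $\operatorname{u}(S)=\max(\operatorname{H}(S)\setminus\{\operatorname{F}(S)\})$, and for $S$ neither ordinary nor almost-ordinary, $\mathcal{B}(S)=(S\cup\{\operatorname{u}(S)\})\setminus\{\operatorname{m}(S)\}$ (a numerical semigroup). $\mathcal{N}_{g,n}$ is the set of numerical semigroups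 $S$ with $\operatorname{g}(S)=g$ and $\operatorname{n}(S)=n$. $\mathcal{T}'_{g,n}$ is the oriented graph with vertex set $\mathcal{N}_{g,n}$ and edges all pairs $(S,\mathcal{B}(S))$ with $S\in\mathcal{N}_{g,n}$ neither ordinary nor almost-ordinary; $S$ is a child of $T$ if $(S,T)$ is an edge, and a leaf is a vertex with no children. -}

module Defs where

open import Data.Bool using (Bool; true; false; not; _∧_; _∨_)
open import Data.Nat using (ℕ; zero; suc; _+_; _*_; _∸_; _≤_; _<_; _≡ᵇ_; _<ᵇ_; _≤ᵇ_; _⊔_)
open import Data.List using (List; []; _∷_; length; filterᵇ; upTo; foldr; map)
open import Data.Bool.ListAction using (any)
open import Data.Product using (Σ; _×_; ∃; ∃-syntax)
open import Relation.Binary.PropositionalEquality using (_≡_)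
open import Relation.Nullary using (¬_)

-- A numerical semigroup, given by its (decidable) membership predicate,
-- together with a bound `cond` beyond which every natural number belongs to S
-- (this witnesses that ℕ ∖ S is finite).
record NumericalSemigroup : Set where
  field
    mem      : ℕ → Bool
    mem-zero : mem 0 ≡ true
    mem-add  : ∀ x y → mem x ≡ true → mem y ≡ true → mem (x + y) ≡ true
    cond     : ℕ
    mem-cond : ∀ x → cond ≤ x → mem x ≡ true

open NumericalSemigroup public

range : ℕ → ℕ → List ℕ
range a b = map (a +_) (upTo (b ∸ a))

maxList : List ℕ → ℕ
maxList = foldr _⊔_ 0

-- H(S), the set of gaps (listed increasingly); every gap is < cond S
gaps : NumericalSemigroup → List ℕ
gaps S = filterᵇ (λ x → not (mem S x)) (upTo (cond S))

genus : NumericalSemigroup → ℕ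
genus S = length (gaps S)

-- F(S) = max H(S)  (only meaningful when H(S) ≠ ∅, which holds whenever g(S) > 0)
frobenius : NumericalSemigroup → ℕ
frobenius S = maxList (gaps S)

sporadic : NumericalSemigroup → ℕ
sporadic S = length (filterᵇ (mem S) (upTo (frobenius S)))

-- m(S) = min (S ∖ {0}); the list below contains cond S + 1 ∈ S, so it is nonempty
multiplicity : NumericalSemigroup → ℕ
multiplicity S with filterᵇ (mem S) (range 1 (cond S + 2))
... | []    = 0
... | x ∷ _ = x

isMinGen : NumericalSemigroup → ℕ → Bool
isMinGen S x = mem S x ∧ not (x ≡ᵇ 0)
               ∧ not (any (λ a → mem S a ∧ mem S (x ∸ a)) (range 1 x))

-- e(S): every minimal generator x satisfies x ≤ cond S + m(S)
-- (if x > cond S + m(S) then x = m(S) + (x - m(S)) with x - m(S) ∈ S ∖ {0}),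
-- so counting over [0, cond S + m(S)] counts all minimal generators.
embdim : NumericalSemigroup → ℕ
embdim S = length (filterᵇ (isMinGen S) (upTo (suc (cond S + multiplicity S))))

secondGap : NumericalSemigroup → ℕ
secondGap S = maxList (filterᵇ (λ x → x <ᵇ frobenius S) (gaps S))

Wilf : NumericalSemigroup → Set
Wilf S = frobenius S + 1 ≤ embdim S * sporadic S

Ordinary : NumericalSemigroup → Set
Ordinary S = ∃[ c ] (∀ x → mem S x ≡ ((x ≡ᵇ 0) ∨ (c ≤ᵇ x)))

AlmostOrdinary : NumericalSemigroup → Set
AlmostOrdinary S = ∃[ g ] ∃[ n ] (2 < g × 2 ≤ n × n ≤ g ×
  (∀ x → mem S x ≡ ((x ≡ᵇ 0) ∨ ((g ≤ᵇ x) ∧ (x ≤ᵇ g + n ∸ 2)) ∨ (g + n ≤ᵇ x))))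

InN : ℕ → ℕ → NumericalSemigroup → Set
InN g n S = genus S ≡ g × sporadic S ≡ n

IsB : NumericalSemigroup → NumericalSemigroup → Set
IsB S T = ∀ x → mem T x ≡ ((mem S x ∨ (x ≡ᵇ secondGap S)) ∧ not (x ≡ᵇ multiplicity S))

-- S is a child of T in 𝒯'_{g,n}: (S, 𝓑(S)) is an edge with S ∈ 𝒩_{g,n}
-- neither ordinary nor almost-ordinary, and 𝓑(S) = T
ChildIn : ℕ → ℕ → NumericalSemigroup → NumericalSemigroup → Set
ChildIn g n S T = InN g n S × ¬ Ordinary S × ¬ AlmostOrdinary S × IsB S T

LeafIn : ℕ → ℕ → NumericalSemigroup → Set
LeafIn g n T = InN g n T × (∀ S → ¬ ChildIn g n S T)

-- Wilf's inequality travels up the edges S ↦ 𝓑(S) of 𝒯′_{g,n}. If S is neither ordinary nor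
-- almost-ordinary then m(S) < u(S) < F(S) (were u(S) < m(S), S would be almost-ordinary, the case
-- m(S) = 2 being excluded by g > 3), so 𝓑(S) has the same Frobenius number; every minimal generator
-- of S other than m(S) and F(S) + m(S) stays minimal in 𝓑(S), which gains the new minimal generators
-- u(S) and 2m(S), whence e(S) ≤ e(𝓑(S)); and n is constant on 𝒩_{g,n}. Since m(S) < m(𝓑(S)),
-- well-founded induction on the multiplicity finishes: a vertex violating the (decidable) inequality
-- would have only children satisfying it, hence no children, i.e. it would be a leaf.

module Submission where

open import Data.Bool using (Bool; true; false; not; _∧_; _∨_; T)
open import Data.Bool.Properties using (T-≡; T-not-≡; ∨-zeroʳ; ∧-zeroʳ)
open import Data.Bool.ListAction using (any)
open import Data.Empty using (⊥; ⊥-elim)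
open import Data.List using ([]; _∷_; length; filterᵇ; upTo; applyUpTo; [_]; _++_)
open import Data.List.Properties using (upTo-∷ʳ; filter-++; length-++; map-upTo)
open import Data.List.Membership.Propositional using (_∈_)
open import Data.List.Membership.Propositional.Properties using (∈-upTo⁺; ∈-upTo⁻; ∈-map⁺; ∈-map⁻; ∈-filter⁺)
open import Data.List.Relation.Unary.All as All using (All; []; _∷_)
open import Data.List.Relation.Unary.All.Properties using (all-filter; filter⁺)
open import Data.List.Relation.Unary.Any using (here; there)
open import Data.Nat
open import Data.Nat.Induction using (<-wellFounded)
open import Data.Nat.Properties
open import Data.Product using (_×_; _,_; proj₁; proj₂; ∃-syntax)
open import Data.Sum using (_⊎_; inj₁; inj₂)
open import Function using (_∘_; Equivalence)
open import Induction.WellFounded using (Acc; acc)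
open import Relation.Binary.Definitions using (tri<; tri≈; tri>)
open import Relation.Binary.PropositionalEquality hiding ([_])
open import Relation.Nullary using (¬_; Dec; yes; no; contradiction)
open import Relation.Nullary.Decidable using (T?)

open import Algebra.Properties.CommutativeSemigroup +-commutativeSemigroup using (interchange; x∙yz≈y∙xz)

open import Defs

T⇒≡true : ∀ {b} → T b → b ≡ true
T⇒≡true = Equivalence.to T-≡

≡true⇒T : ∀ {b} → b ≡ true → T b
≡true⇒T = Equivalence.from T-≡

¬≡true⇒≡false : ∀ {b} → ¬ b ≡ true → b ≡ false
¬≡true⇒≡false {false} _  = refl
¬≡true⇒≡false {true}  ¬t = contradiction refl ¬t

¬≡false⇒≡true : ∀ {b} → ¬ b ≡ false → b ≡ true
¬≡false⇒≡true {true}  _  = refl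
¬≡false⇒≡true {false} ¬f = contradiction refl ¬f

∧≡true⇒ : ∀ {a b} → a ∧ b ≡ true → a ≡ true × b ≡ true
∧≡true⇒ {true} {true} _ = refl , refl

≡ᵇ-refl : ∀ x → (x ≡ᵇ x) ≡ true
≡ᵇ-refl x = T⇒≡true (≡⇒≡ᵇ x x refl)

≢⇒≡ᵇ-false : ∀ {x y} → x ≢ y → (x ≡ᵇ y) ≡ false
≢⇒≡ᵇ-false {x} {y} x≢y = ¬≡true⇒≡false (x≢y ∘ ≡ᵇ⇒≡ x y ∘ ≡true⇒T)

≤⇒≤ᵇ-true : ∀ {x y} → x ≤ y → (x ≤ᵇ y) ≡ true
≤⇒≤ᵇ-true = T⇒≡true ∘ ≤⇒≤ᵇ

>⇒≤ᵇ-false : ∀ {x y} → y < x → (x ≤ᵇ y) ≡ false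
>⇒≤ᵇ-false {x} {y} y<x = ¬≡true⇒≡false (<⇒≱ y<x ∘ ≤ᵇ⇒≤ x y ∘ ≡true⇒T)

𝟙 : Bool → ℕ
𝟙 true  = 1
𝟙 false = 0

Σ< : ℕ → (ℕ → ℕ) → ℕ
Σ< zero    f = 0
Σ< (suc n) f = Σ< n f + f n

Σ<-mono-≤ : ∀ n {f h : ℕ → ℕ} → (∀ x → f x ≤ h x) → Σ< n f ≤ Σ< n h
Σ<-mono-≤ zero    f≤h = z≤n
Σ<-mono-≤ (suc n) f≤h = +-mono-≤ (Σ<-mono-≤ n f≤h) (f≤h n)

Σ<-+ : ∀ n (f h : ℕ → ℕ) → Σ< n (λ x → f x + h x) ≡ Σ< n f + Σ< n h
Σ<-+ zero    f h = refl
Σ<-+ (suc n) f h = begin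
  Σ< n (λ x → f x + h x) + (f n + h n)  ≡⟨ cong (_+ (f n + h n)) (Σ<-+ n f h) ⟩
  Σ< n f + Σ< n h + (f n + h n)         ≡⟨ interchange (Σ< n f) (Σ< n h) (f n) (h n) ⟩
  Σ< n f + f n + (Σ< n h + h n)         ∎
  where open ≡-Reasoning

Σ<-stable : ∀ {f : ℕ → ℕ} {N} → (∀ x → N ≤ x → f x ≡ 0) → ∀ {L} → N ≤ L → Σ< L f ≡ Σ< N f
Σ<-stable f≡0 N≤L with m≤n⇒m<n∨m≡n N≤L
... | inj₂ refl = refl
Σ<-stable {f} {N} f≡0 {suc L} _ | inj₁ (s≤s N≤L) = begin
  Σ< L f + f L  ≡⟨ cong (Σ< L f +_) (f≡0 L N≤L) ⟩
  Σ< L f + 0    ≡⟨ +-identityʳ _ ⟩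
  Σ< L f        ≡⟨ Σ<-stable f≡0 N≤L ⟩
  Σ< N f        ∎
  where open ≡-Reasoning

count : (ℕ → Bool) → ℕ → ℕ
count p n = Σ< n (𝟙 ∘ p)

length-filterᵇ-upTo : ∀ (p : ℕ → Bool) n → length (filterᵇ p (upTo n)) ≡ count p n
length-filterᵇ-upTo p zero    = refl
length-filterᵇ-upTo p (suc n) = begin
  length (filterᵇ p (upTo (suc n)))                  ≡⟨ cong (length ∘ filterᵇ p) (sym (upTo-∷ʳ n)) ⟩
  length (filterᵇ p (upTo n ++ [ n ]))               ≡⟨ cong length (filter-++ _ (upTo n) [ n ]) ⟩
  length (filterᵇ p (upTo n) ++ filterᵇ p [ n ])     ≡⟨ length-++ (filterᵇ p (upTo n)) ⟩
  length (filterᵇ p (upTo n)) + length (filterᵇ p [ n ])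
    ≡⟨ cong₂ _+_ (length-filterᵇ-upTo p n) length-filterᵇ-[n] ⟩
  count p n + 𝟙 (p n)                                ∎
  where
  open ≡-Reasoning
  length-filterᵇ-[n] : length (filterᵇ p [ n ]) ≡ 𝟙 (p n)
  length-filterᵇ-[n] with p n
  ... | true  = refl
  ... | false = refl

count-≡ᵇ≡0 : ∀ c n → n ≤ c → count (_≡ᵇ c) n ≡ 0
count-≡ᵇ≡0 c zero    _   = refl
count-≡ᵇ≡0 c (suc n) n<c rewrite ≢⇒≡ᵇ-false (<⇒≢ n<c) | count-≡ᵇ≡0 c n (<⇒≤ n<c) = refl

count-≡ᵇ≡1 : ∀ c n → c < n → count (_≡ᵇ c) n ≡ 1
count-≡ᵇ≡1 c (suc n) c<1+n with m≤n⇒m<n∨m≡n (≤-pred c<1+n)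
... | inj₁ c<n  rewrite ≢⇒≡ᵇ-false (>⇒≢ c<n) | count-≡ᵇ≡1 c n c<n = refl
... | inj₂ refl rewrite ≡ᵇ-refl c | count-≡ᵇ≡0 c c ≤-refl = refl

count-≡ᵇ≤1 : ∀ c n → count (_≡ᵇ c) n ≤ 1
count-≡ᵇ≤1 c n with c <? n
... | yes c<n = ≤-reflexive (count-≡ᵇ≡1 c n c<n)
... | no  c≮n rewrite count-≡ᵇ≡0 c n (≮⇒≥ c≮n) = z≤n

count-⊆-pair : ∀ {p : ℕ → Bool} {a b} n → (∀ x → p x ≡ true → x ≡ a ⊎ x ≡ b) → count p n ≤ 2
count-⊆-pair {p} {a} {b} n p⊆ab = begin
  count p n                               ≤⟨ Σ<-mono-≤ n pointwise ⟩
  Σ< n (λ x → 𝟙 (x ≡ᵇ a) + 𝟙 (x ≡ᵇ b))    ≡⟨ Σ<-+ n _ _ ⟩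
  count (_≡ᵇ a) n + count (_≡ᵇ b) n       ≤⟨ +-mono-≤ (count-≡ᵇ≤1 a n) (count-≡ᵇ≤1 b n) ⟩
  2                                       ∎
  where
  open ≤-Reasoning
  pointwise : ∀ x → 𝟙 (p x) ≤ 𝟙 (x ≡ᵇ a) + 𝟙 (x ≡ᵇ b)
  pointwise x with p x in px
  ... | false = z≤n
  ... | true with p⊆ab x px
  ...   | inj₁ refl rewrite ≡ᵇ-refl x = s≤s z≤n
  ...   | inj₂ refl rewrite ≡ᵇ-refl x = m≤n+m 1 _

count-exchange : ∀ {p q : ℕ → Bool} {a b c d} n →
  (∀ x → p x ≡ true → x ≢ a → x ≢ b → q x ≡ true) →
  p c ≡ false → p d ≡ false → q c ≡ true → q d ≡ true → c ≢ d → c < n → d < n →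
  count p n ≤ count q n
count-exchange {p} {q} {a} {b} {c} {d} n p⊆q∪ab pc pd qc qd c≢d c<n d<n =
  +-cancelʳ-≤ 1 _ _ (+-cancelʳ-≤ 1 _ _ (begin
    count p n + 1 + 1
      ≡⟨ cong₂ (λ i j → count p n + i + j) (sym (count-≡ᵇ≡1 c n c<n)) (sym (count-≡ᵇ≡1 d n d<n)) ⟩
    count p n + count (_≡ᵇ c) n + count (_≡ᵇ d) n
      ≡⟨ sym (Σ<-+₃ (𝟙 ∘ p) _ _) ⟩
    Σ< n (λ x → 𝟙 (p x) + 𝟙 (x ≡ᵇ c) + 𝟙 (x ≡ᵇ d))
      ≤⟨ Σ<-mono-≤ n pointwise ⟩
    Σ< n (λ x → 𝟙 (q x) + 𝟙 (x ≡ᵇ a) + 𝟙 (x ≡ᵇ b))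
      ≡⟨ Σ<-+₃ (𝟙 ∘ q) _ _ ⟩
    count q n + count (_≡ᵇ a) n + count (_≡ᵇ b) n
      ≤⟨ +-mono-≤ (+-monoʳ-≤ (count q n) (count-≡ᵇ≤1 a n)) (count-≡ᵇ≤1 b n) ⟩
    count q n + 1 + 1 ∎))
  where
  open ≤-Reasoning
  Σ<-+₃ : ∀ (f g h : ℕ → ℕ) → Σ< n (λ x → f x + g x + h x) ≡ Σ< n f + Σ< n g + Σ< n h
  Σ<-+₃ f g h = trans (Σ<-+ n _ h) (cong (_+ Σ< n h) (Σ<-+ n f g))
  pointwise : ∀ x → 𝟙 (p x) + 𝟙 (x ≡ᵇ c) + 𝟙 (x ≡ᵇ d) ≤ 𝟙 (q x) + 𝟙 (x ≡ᵇ a) + 𝟙 (x ≡ᵇ b)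
  pointwise x with x ≟ c | x ≟ d
  ... | yes refl | _ rewrite pc | ≡ᵇ-refl x | ≢⇒≡ᵇ-false c≢d | qc = s≤s z≤n
  ... | no x≢c | yes refl rewrite pd | ≢⇒≡ᵇ-false x≢c | ≡ᵇ-refl x | qd = s≤s z≤n
  ... | no x≢c | no x≢d rewrite ≢⇒≡ᵇ-false x≢c | ≢⇒≡ᵇ-false x≢d with p x in px
  ...   | false = z≤n
  ...   | true with x ≟ a | x ≟ b
  ...     | yes refl | _ rewrite ≡ᵇ-refl x = ≤-trans (m≤n+m 1 (𝟙 (q x))) (m≤m+n _ _)
  ...     | no _ | yes refl rewrite ≡ᵇ-refl x = m≤n+m 1 _
  ...     | no x≢a | no x≢b rewrite p⊆q∪ab x px x≢a x≢b = s≤s z≤n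

≤-maxList : ∀ {x} xs → x ∈ xs → x ≤ maxList xs
≤-maxList (y ∷ xs) (here refl) = m≤m⊔n y (maxList xs)
≤-maxList (y ∷ xs) (there x∈xs) = ≤-trans (≤-maxList xs x∈xs) (m≤n⊔m y (maxList xs))

maxList-∷-∈ : ∀ y xs → maxList (y ∷ xs) ∈ y ∷ xs
maxList-∷-∈ y []       = here (⊔-identityʳ y)
maxList-∷-∈ y (z ∷ xs) with ⊔-sel y (maxList (z ∷ xs))
... | inj₁ max≡y    = here max≡y
... | inj₂ max≡rest = there (subst (_∈ z ∷ xs) (sym max≡rest) (maxList-∷-∈ z xs))

maxList-∈ : ∀ {x xs} → x ∈ xs → maxList xs ∈ xs
maxList-∈ {xs = y ∷ ys} _ = maxList-∷-∈ y ys

any-false : ∀ (p : ℕ → Bool) {xs} → All (λ x → p x ≡ false) xs → any p xs ≡ false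
any-false p []          = refl
any-false p (px ∷ pxs) rewrite px = any-false p pxs

any-true : ∀ (p : ℕ → Bool) {x} xs → x ∈ xs → p x ≡ true → any p xs ≡ true
any-true p (y ∷ xs) (here refl)  py rewrite py = refl
any-true p (y ∷ xs) (there x∈xs) px rewrite any-true p xs x∈xs px = ∨-zeroʳ (p y)

∈-range⁺ : ∀ {a b x} → a ≤ x → x < b → x ∈ range a b
∈-range⁻ : ∀ {a b x} → x ∈ range a b → a ≤ x × x < b
∈-range⁺ {a} {b} {x} a≤x x<b =
  subst (_∈ range a b) (m+[n∸m]≡n a≤x) (∈-map⁺ (a +_) (∈-upTo⁺ (∸-monoˡ-< x<b a≤x)))
∈-range⁻ {a} {b} x∈range with ∈-map⁻ (a +_) x∈range
... | y , y∈upTo , refl = m≤m+n a y , (begin-strict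
  a + y        <⟨ +-monoʳ-< a (∈-upTo⁻ y∈upTo) ⟩
  a + (b ∸ a)  ≡⟨ m+[n∸m]≡n a≤b ⟩
  b            ∎)
  where
  open ≤-Reasoning
  a≤b : a ≤ b
  a≤b with a ≤? b
  ... | yes a≤b = a≤b
  ... | no  a≰b = ⊥-elim (n≮0 (subst (y <_) (m≤n⇒m∸n≡0 (<⇒≤ (≰⇒> a≰b))) (∈-upTo⁻ y∈upTo)))

filterᵇ-applyUpTo-head : ∀ (p : ℕ → Bool) f k {j} → j < k → p (f j) ≡ true →
  ∃[ i ] ∃[ rest ] (filterᵇ p (applyUpTo f k) ≡ f i ∷ rest × p (f i) ≡ true ×
                    (∀ j → j < i → p (f j) ≡ false))
filterᵇ-applyUpTo-head p f (suc k) {j} j<k pfj with p (f 0) in pf0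
... | true = 0 , _ , refl , pf0 , λ _ ()
filterᵇ-applyUpTo-head p f (suc k) {zero}  _   pfj | false = contradiction (trans (sym pf0) pfj) λ ()
filterᵇ-applyUpTo-head p f (suc k) {suc j} j<k pfj | false
  with filterᵇ-applyUpTo-head p (f ∘ suc) k (≤-pred j<k) pfj
... | i , rest , eq , pfi , before = suc i , rest , eq , pfi , earlier
  where
  earlier : ∀ j → j < suc i → p (f j) ≡ false
  earlier zero    _   = pf0
  earlier (suc j) j<i = before j (≤-pred j<i)

multiplicity-head : ∀ S {x xs} → filterᵇ (mem S) (range 1 (cond S + 2)) ≡ x ∷ xs → multiplicity S ≡ x
multiplicity-head S eq with filterᵇ (mem S) (range 1 (cond S + 2))
multiplicity-head S refl | _ ∷ _ = refl

Irreducible : NumericalSemigroup → ℕ → Set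
Irreducible S x = ∀ {a b} → 1 ≤ a → 1 ≤ b → a + b ≡ x → mem S a ≡ true → mem S b ≡ true → ⊥

module _ (S : NumericalSemigroup) where

  mem-gap-≢ : ∀ {x y} → mem S x ≡ true → mem S y ≡ false → x ≢ y
  mem-gap-≢ mem-x gap-y refl = contradiction (trans (sym mem-x) gap-y) λ ()

  gap<cond : ∀ {x} → mem S x ≡ false → x < cond S
  gap<cond {x} gap = ≰⇒> λ cond≤x → mem-gap-≢ (mem-cond S x cond≤x) gap refl

  gaps-gap : All (λ x → mem S x ≡ false) (gaps S)
  gaps-gap = All.map (Equivalence.to T-not-≡) (all-filter (T? ∘ not ∘ mem S) (upTo (cond S)))

  gap∈gaps : ∀ {x} → mem S x ≡ false → x ∈ gaps S
  gap∈gaps gap = ∈-filter⁺ (T? ∘ not ∘ mem S) (∈-upTo⁺ (gap<cond gap)) (Equivalence.from T-not-≡ gap)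

  positive-genus⇒gap : 0 < genus S → ∃[ x ] mem S x ≡ false
  positive-genus⇒gap 0<genus with gaps S | gaps-gap
  ... | x ∷ _ | gap ∷ _ = x , gap

  gap-positive : ∀ {x} → mem S x ≡ false → 1 ≤ x
  gap-positive {zero}  gap = ⊥-elim (mem-gap-≢ (mem-zero S) gap refl)
  gap-positive {suc x} _   = s≤s z≤n

  gap⇒1-gap : ∀ {x} → mem S x ≡ false → mem S 1 ≡ false
  gap⇒1-gap {x} gap = ¬≡true⇒≡false λ mem1 → mem-gap-≢ (all-mem mem1 x) gap refl
    where
    all-mem : mem S 1 ≡ true → ∀ y → mem S y ≡ true
    all-mem mem1 zero    = mem-zero S
    all-mem mem1 (suc y) = mem-add S 1 y mem1 (all-mem mem1 y)

  gap≤frobenius : ∀ {x} → mem S x ≡ false → x ≤ frobenius S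
  gap≤frobenius gap = ≤-maxList (gaps S) (gap∈gaps gap)

  frobenius-gap : ∀ {x} → mem S x ≡ false → mem S (frobenius S) ≡ false
  frobenius-gap gap = All.lookup gaps-gap (maxList-∈ (gap∈gaps gap))

  frobenius<⇒mem : ∀ {y} → frobenius S < y → mem S y ≡ true
  frobenius<⇒mem F<y = ¬≡false⇒≡true λ gap → <⇒≱ F<y (gap≤frobenius gap)

  private
    gap∈below-frobenius : ∀ {x} → mem S x ≡ false → x < frobenius S →
      x ∈ filterᵇ (_<ᵇ frobenius S) (gaps S)
    gap∈below-frobenius gap x<F = ∈-filter⁺ (T? ∘ (_<ᵇ frobenius S)) (gap∈gaps gap) (<⇒<ᵇ x<F)

  ≤secondGap : ∀ {x} → mem S x ≡ false → x < frobenius S → x ≤ secondGap S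
  ≤secondGap gap x<F = ≤-maxList _ (gap∈below-frobenius gap x<F)

  gap⇒≤secondGap⊎≡frobenius : ∀ {x} → mem S x ≡ false → x ≤ secondGap S ⊎ x ≡ frobenius S
  gap⇒≤secondGap⊎≡frobenius gap with m≤n⇒m<n∨m≡n (gap≤frobenius gap)
  ... | inj₁ x<F = inj₁ (≤secondGap gap x<F)
  ... | inj₂ x≡F = inj₂ x≡F

  secondGap<gap⇒≡frobenius : ∀ {x} → mem S x ≡ false → secondGap S < x → x ≡ frobenius S
  secondGap<gap⇒≡frobenius gap u<x with gap⇒≤secondGap⊎≡frobenius gap
  ... | inj₁ x≤u = contradiction x≤u (<⇒≱ u<x)
  ... | inj₂ x≡F = x≡F

  secondGap-gap : ∀ {x} → mem S x ≡ false → x < frobenius S →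
    mem S (secondGap S) ≡ false × secondGap S < frobenius S
  secondGap-gap gap x<F =
    All.lookup (filter⁺ (T? ∘ (_<ᵇ frobenius S)) gaps-gap) u∈ ,
    <ᵇ⇒< _ _ (All.lookup (all-filter (T? ∘ (_<ᵇ frobenius S)) (gaps S)) u∈)
    where u∈ = maxList-∈ (gap∈below-frobenius gap x<F)

  multiplicity-spec : ∃[ i ] (multiplicity S ≡ suc i × mem S (suc i) ≡ true ×
                               (∀ j → j < i → mem S (suc j) ≡ false))
  multiplicity-spec
    with filterᵇ-applyUpTo-head (mem S) suc (suc (cond S)) ≤-refl (mem-cond S _ (n≤1+n _))
  ... | i , _ , head≡ , mem-i , before =
    i , multiplicity-head S (trans (cong (filterᵇ (mem S)) range≡) head≡) , mem-i , before
    where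
    range≡ : range 1 (cond S + 2) ≡ applyUpTo suc (suc (cond S))
    range≡ = trans (map-upTo suc (cond S + 2 ∸ 1)) (cong (applyUpTo suc ∘ (_∸ 1)) (+-comm (cond S) 2))

  multiplicity-positive : 1 ≤ multiplicity S
  multiplicity-positive with multiplicity-spec
  ... | _ , m≡ , _ rewrite m≡ = s≤s z≤n

  multiplicity-mem : mem S (multiplicity S) ≡ true
  multiplicity-mem with multiplicity-spec
  ... | _ , m≡ , mem-m , _ rewrite m≡ = mem-m

  <multiplicity⇒gap : ∀ {y} → 1 ≤ y → y < multiplicity S → mem S y ≡ false
  <multiplicity⇒gap {suc y} _ y<m with multiplicity-spec
  ... | _ , m≡ , _ , before rewrite m≡ = before y (≤-pred y<m)

  multiplicity-≤ : ∀ {y} → 1 ≤ y → mem S y ≡ true → multiplicity S ≤ y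
  multiplicity-≤ 1≤y mem-y = ≮⇒≥ λ y<m → mem-gap-≢ mem-y (<multiplicity⇒gap 1≤y y<m) refl

  isMinGen-intro : ∀ {x} → mem S x ≡ true → 1 ≤ x → Irreducible S x → isMinGen S x ≡ true
  isMinGen-intro {suc x} mem-x _ irreducible
    rewrite mem-x = cong not (any-false (λ a → mem S a ∧ mem S (suc x ∸ a)) (All.tabulate unsplit))
    where
    unsplit : ∀ {a} → a ∈ range 1 (suc x) → (mem S a ∧ mem S (suc x ∸ a)) ≡ false
    unsplit {a} a∈range with ∈-range⁻ a∈range | mem S a in mem-a | mem S (suc x ∸ a) in mem-rest
    ... | 1≤a , a<x | true  | true  =
      ⊥-elim (irreducible 1≤a (m<n⇒0<n∸m a<x) (m+[n∸m]≡n (<⇒≤ a<x)) mem-a mem-rest)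
    ... | _         | true  | false = refl
    ... | _         | false | _     = refl

  isMinGen-elim : ∀ {x} → isMinGen S x ≡ true → mem S x ≡ true × 1 ≤ x × Irreducible S x
  isMinGen-elim {x} minGen with ∧≡true⇒ minGen
  ... | mem-x , rest with ∧≡true⇒ rest
  ... | x≢0 , unsplit = mem-x , positive x≢0 , irreducible
    where
    positive : ∀ {y} → not (y ≡ᵇ 0) ≡ true → 1 ≤ y
    positive {suc y} _ = s≤s z≤n
    irreducible : Irreducible S x
    irreducible {a} {b} 1≤a 1≤b a+b≡x mem-a mem-b =
      contradiction (trans (sym (cong not (any-true _ (range 1 x) (∈-range⁺ 1≤a a<x) split))) unsplit) λ ()
      where
      a<x : a < x
      a<x = subst (a <_) a+b≡x (m<m+n a 1≤b)
      split : (mem S a ∧ mem S (x ∸ a)) ≡ true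
      split rewrite mem-a | sym a+b≡x | m+n∸m≡n a b = mem-b

  count-isMinGen : ∀ {L} → suc (cond S + multiplicity S) ≤ L → count (isMinGen S) L ≡ embdim S
  count-isMinGen L≥ =
    trans (Σ<-stable large L≥) (sym (length-filterᵇ-upTo (isMinGen S) (suc (cond S + multiplicity S))))
    where
    large : ∀ x → suc (cond S + multiplicity S) ≤ x → 𝟙 (isMinGen S x) ≡ 0
    large x x> = cong 𝟙 (¬≡true⇒≡false λ minGen →
      proj₂ (proj₂ (isMinGen-elim minGen)) multiplicity-positive (≤-trans (s≤s z≤n) cond<rest)
        (m+[n∸m]≡n m≤x) multiplicity-mem (mem-cond S _ (<⇒≤ cond<rest)))
      where
      m = multiplicity S
      m≤x : m ≤ x
      m≤x = ≤-trans (m≤n+m m (cond S)) (≤-trans (n≤1+n _) x>)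
      cond<rest : cond S < x ∸ m
      cond<rest = subst (_≤ x ∸ m) (m+n∸n≡m (suc (cond S)) m) (∸-monoˡ-≤ m x>)

  isMinGen-double-multiplicity : isMinGen S (multiplicity S + multiplicity S) ≡ false
  isMinGen-double-multiplicity = ¬≡true⇒≡false λ minGen → proj₂ (proj₂ (isMinGen-elim minGen))
    multiplicity-positive multiplicity-positive refl multiplicity-mem multiplicity-mem

ordinary-intro : ∀ S c → (∀ {x} → 1 ≤ x → x < c → mem S x ≡ false) → (∀ {x} → c ≤ x → mem S x ≡ true) →
  Ordinary S
ordinary-intro S c below above = c , membership
  where
  membership : ∀ x → mem S x ≡ ((x ≡ᵇ 0) ∨ (c ≤ᵇ x))
  membership zero = mem-zero S
  membership (suc x) with c ≤? suc x
  ... | yes c≤x = trans (above c≤x) (sym (≤⇒≤ᵇ-true c≤x))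
  ... | no  c≰x = trans (below (s≤s z≤n) (≰⇒> c≰x)) (sym (>⇒≤ᵇ-false (≰⇒> c≰x)))

almostOrdinary-intro : ∀ S a → 2 < a → a < frobenius S → frobenius S < a + a →
  mem S (frobenius S) ≡ false →
  (∀ {x} → 1 ≤ x → x < a → mem S x ≡ false) →
  (∀ {x} → a ≤ x → x < frobenius S → mem S x ≡ true) →
  AlmostOrdinary S
almostOrdinary-intro S a 2<a a<F F<2a F-gap below between =
  a , n , 2<a , m+n≤o⇒m≤o∸n 2 (s≤s a<F) , m≤n+o⇒m∸n≤o (suc F) a F<2a , membership
  where
  F = frobenius S
  n = suc F ∸ a
  0<F : 0 < F
  0<F = ≤-trans (s≤s z≤n) a<F
  membership : ∀ x → mem S x ≡ ((x ≡ᵇ 0) ∨ ((a ≤ᵇ x) ∧ (x ≤ᵇ a + n ∸ 2)) ∨ (a + n ≤ᵇ x))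
  membership x rewrite m+[n∸m]≡n (≤-trans (<⇒≤ a<F) (n≤1+n F)) with <-cmp x F
  ... | tri< x<F _ _ with x ≟ 0 | x <? a
  ...   | yes refl | _ = mem-zero S
  ...   | no x≢0 | yes x<a rewrite ≢⇒≡ᵇ-false x≢0 | >⇒≤ᵇ-false x<a | >⇒≤ᵇ-false (m<n⇒m<1+n x<F) =
    below (n≢0⇒n>0 x≢0) x<a
  ...   | no x≢0 | no x≮a rewrite ≢⇒≡ᵇ-false x≢0 | ≤⇒≤ᵇ-true (≮⇒≥ x≮a) | ≤⇒≤ᵇ-true (∸-monoˡ-≤ 1 x<F) =
    between (≮⇒≥ x≮a) x<F
  membership x | tri≈ _ refl _
    rewrite ≢⇒≡ᵇ-false (>⇒≢ 0<F) | ≤⇒≤ᵇ-true (<⇒≤ a<F) | >⇒≤ᵇ-false (∸-monoʳ-< z<s 0<F)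
          | >⇒≤ᵇ-false (n<1+n F) = F-gap
  membership x | tri> _ _ F<x rewrite ≤⇒≤ᵇ-true F<x =
    trans (frobenius<⇒mem S F<x) (sym (trans (cong ((x ≡ᵇ 0) ∨_) (∨-zeroʳ _)) (∨-zeroʳ _)))

multiplicity<frobenius : ∀ S {x} → mem S x ≡ false → ¬ Ordinary S → multiplicity S < frobenius S
multiplicity<frobenius S gap ¬ordinary with <-cmp (multiplicity S) (frobenius S)
... | tri< m<F _ _ = m<F
... | tri≈ _ m≡F _ = contradiction m≡F (mem-gap-≢ S (multiplicity-mem S) (frobenius-gap S gap))
... | tri> _ _ F<m = contradiction
  (ordinary-intro S _ (<multiplicity⇒gap S) (λ m≤x → frobenius<⇒mem S (<-≤-trans F<m m≤x))) ¬ordinary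

¬ordinary⇒secondGap-gap : ∀ S {x} → mem S x ≡ false → ¬ Ordinary S →
  mem S (secondGap S) ≡ false × secondGap S < frobenius S
¬ordinary⇒secondGap-gap S gap ¬ordinary =
  secondGap-gap S (gap⇒1-gap S gap)
    (≤-<-trans (multiplicity-positive S) (multiplicity<frobenius S gap ¬ordinary))

secondGap<2⇒genus≤2 : ∀ S → secondGap S < 2 → genus S ≤ 2
secondGap<2⇒genus≤2 S u<2 = begin
  genus S                      ≡⟨ length-filterᵇ-upTo (not ∘ mem S) (cond S) ⟩
  count (not ∘ mem S) (cond S) ≤⟨ count-⊆-pair (cond S) gap≡1⊎F ⟩
  2                            ∎
  where
  open ≤-Reasoning
  gap≡1⊎F : ∀ y → not (mem S y) ≡ true → y ≡ 1 ⊎ y ≡ frobenius S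
  gap≡1⊎F y not-mem with Equivalence.to T-not-≡ (≡true⇒T not-mem)
  ... | gap with gap⇒≤secondGap⊎≡frobenius S gap
  ...   | inj₁ y≤u = inj₁ (≤-antisym (≤-pred (≤-<-trans y≤u u<2)) (gap-positive S gap))
  ...   | inj₂ y≡F = inj₂ y≡F

secondGap<multiplicity⇒almostOrdinary : ∀ S → 2 < multiplicity S → mem S (frobenius S) ≡ false →
  multiplicity S < frobenius S → secondGap S < multiplicity S → AlmostOrdinary S
secondGap<multiplicity⇒almostOrdinary S 2<m F-gap m<F u<m =
  almostOrdinary-intro S m 2<m m<F F<2m F-gap (<multiplicity⇒gap S) between
  where
  m = multiplicity S
  F = frobenius S
  gap<m⊎≡F : ∀ {x} → mem S x ≡ false → x < m ⊎ x ≡ F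
  gap<m⊎≡F gap with gap⇒≤secondGap⊎≡frobenius S gap
  ... | inj₁ x≤u = inj₁ (≤-<-trans x≤u u<m)
  ... | inj₂ x≡F = inj₂ x≡F
  F∸m-gap : mem S (F ∸ m) ≡ false
  F∸m-gap = ¬≡true⇒≡false λ mem-F∸m → mem-gap-≢ S
    (mem-add S m (F ∸ m) (multiplicity-mem S) mem-F∸m) F-gap (m+[n∸m]≡n (<⇒≤ m<F))
  F<2m : F < m + m
  F<2m with gap<m⊎≡F F∸m-gap
  ... | inj₁ F∸m<m = subst (_< m + m) (m+[n∸m]≡n (<⇒≤ m<F)) (+-monoʳ-< m F∸m<m)
  ... | inj₂ F∸m≡F = contradiction F∸m≡F (<⇒≢ (∸-monoʳ-< (multiplicity-positive S) (<⇒≤ m<F)))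
  between : ∀ {x} → m ≤ x → x < F → mem S x ≡ true
  between {x} m≤x x<F with mem S x in mem-x
  ... | true  = refl
  ... | false with gap<m⊎≡F mem-x
  ...   | inj₁ x<m = contradiction m≤x (<⇒≱ x<m)
  ...   | inj₂ x≡F = contradiction x≡F (<⇒≢ x<F)

multiplicity<secondGap : ∀ S → 3 < genus S → ¬ Ordinary S → ¬ AlmostOrdinary S →
  multiplicity S < secondGap S
multiplicity<secondGap S 3<g ¬ordinary ¬almostOrdinary with positive-genus⇒gap S (<-trans z<s 3<g)
... | _ , gap with ¬ordinary⇒secondGap-gap S gap ¬ordinary | <-cmp (multiplicity S) (secondGap S)
...   | _     , _ | tri< m<u _ _ = m<u
...   | u-gap , _ | tri≈ _ m≡u _ = contradiction m≡u (mem-gap-≢ S (multiplicity-mem S) u-gap)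
...   | _     , _ | tri> _ _ u<m = contradiction
  (secondGap<multiplicity⇒almostOrdinary S 2<m (frobenius-gap S gap)
     (multiplicity<frobenius S gap ¬ordinary) u<m)
  ¬almostOrdinary
  where
  1<m : 1 < multiplicity S
  1<m = ≤∧≢⇒< (multiplicity-positive S) (≢-sym (mem-gap-≢ S (multiplicity-mem S) (gap⇒1-gap S gap)))
  2<m : 2 < multiplicity S
  2<m = ≤∧≢⇒< 1<m λ 2≡m →
    <⇒≱ 3<g (≤-trans (secondGap<2⇒genus≤2 S (subst (secondGap S <_) (sym 2≡m) u<m)) (n≤1+n 2))

module B-membership {A T : NumericalSemigroup} (isB : IsB A T) where

  B-mem-intro : ∀ {y} → mem A y ≡ true → y ≢ multiplicity A → mem T y ≡ true
  B-mem-intro {y} mem-y y≢m rewrite isB y | mem-y | ≢⇒≡ᵇ-false y≢m = refl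

  B-mem-secondGap : mem A (secondGap A) ≡ false → secondGap A ≢ multiplicity A → mem T (secondGap A) ≡ true
  B-mem-secondGap u-gap u≢m
    rewrite isB (secondGap A) | u-gap | ≡ᵇ-refl (secondGap A) | ≢⇒≡ᵇ-false u≢m = refl

  B-gap-intro : ∀ {y} → mem A y ≡ false → y ≢ secondGap A → mem T y ≡ false
  B-gap-intro {y} gap y≢u rewrite isB y | gap | ≢⇒≡ᵇ-false y≢u = refl

  B-gap-multiplicity : mem T (multiplicity A) ≡ false
  B-gap-multiplicity rewrite isB (multiplicity A) | ≡ᵇ-refl (multiplicity A) = ∧-zeroʳ _

  B-mem-elim : ∀ {y} → mem T y ≡ true → y ≢ multiplicity A × (mem A y ≡ true ⊎ y ≡ secondGap A)
  B-mem-elim {y} mem-y = mem-gap-≢ T mem-y B-gap-multiplicity , mem⊎≡u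
    where
    mem⊎≡u : mem A y ≡ true ⊎ y ≡ secondGap A
    mem⊎≡u with mem A y in mem-A-y | y ≟ secondGap A
    ... | true  | _        = inj₁ refl
    ... | false | yes y≡u  = inj₂ y≡u
    ... | false | no  y≢u  = ⊥-elim (mem-gap-≢ T mem-y (B-gap-intro mem-A-y y≢u) refl)

module _ {A T : NumericalSemigroup} (isB : IsB A T) (u-gap : mem A (secondGap A) ≡ false)
         (m<u : multiplicity A < secondGap A) (u<F : secondGap A < frobenius A) where

  open B-membership {A} {T} isB

  private
    m = multiplicity A
    u = secondGap A
    F = frobenius A
    m<F = <-trans m<u u<F
    m-pos = multiplicity-positive A

  B-positive⇒>multiplicity : ∀ {y} → mem T y ≡ true → 1 ≤ y → m < y
  B-positive⇒>multiplicity mem-y 1≤y with B-mem-elim mem-y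
  ... | y≢m , inj₁ mem-A-y = ≤∧≢⇒< (multiplicity-≤ A 1≤y mem-A-y) (≢-sym y≢m)
  ... | _   , inj₂ y≡u     = subst (m <_) (sym y≡u) m<u

  frobenius-B : frobenius T ≡ F
  frobenius-B = ≤-antisym
    (≮⇒≥ λ F<F-T → mem-gap-≢ T (B-mem-intro (frobenius<⇒mem A F<F-T) (>⇒≢ (<-trans m<F F<F-T)))
                              (frobenius-gap T F-gap-T) refl)
    (gap≤frobenius T F-gap-T)
    where
    F-gap-T : mem T F ≡ false
    F-gap-T = B-gap-intro (frobenius-gap A u-gap) (>⇒≢ u<F)

  multiplicity<multiplicity-B : m < multiplicity T
  multiplicity<multiplicity-B = B-positive⇒>multiplicity (multiplicity-mem T) (multiplicity-positive T)

  -- With c = m + d, irreducibility of x = m + (u + d) makes u + d a gap above u, i.e. F.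
  irreducible-u+⇒≡F+m : ∀ {x c} → Irreducible A x → mem T c ≡ true → 1 ≤ c → u + c ≡ x → x ≡ F + m
  irreducible-u+⇒≡F+m {x} {c} irreducible mem-c 1≤c u+c≡x = begin
    x            ≡⟨ sym m+[u+d]≡x ⟩
    m + (u + d)  ≡⟨ cong (m +_) (secondGap<gap⇒≡frobenius A rest-gap (m<m+n u 0<d)) ⟩
    m + F        ≡⟨ +-comm m F ⟩
    F + m        ∎
    where
    open ≡-Reasoning
    m<c = B-positive⇒>multiplicity mem-c 1≤c
    d = c ∸ m
    0<d : 0 < d
    0<d = m<n⇒0<n∸m m<c
    m+[u+d]≡x : m + (u + d) ≡ x
    m+[u+d]≡x = trans (x∙yz≈y∙xz m u d) (trans (cong (u +_) (m+[n∸m]≡n (<⇒≤ m<c))) u+c≡x)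
    rest-gap : mem A (u + d) ≡ false
    rest-gap = ¬≡true⇒≡false (irreducible m-pos (≤-trans 0<d (m≤n+m d u)) m+[u+d]≡x (multiplicity-mem A))

  isMinGen-B : ∀ x → isMinGen A x ≡ true → x ≢ m → x ≢ F + m → isMinGen T x ≡ true
  isMinGen-B x minGen x≢m x≢F+m with isMinGen-elim A minGen
  ... | mem-x , 1≤x , irreducible = isMinGen-intro T (B-mem-intro mem-x x≢m) 1≤x irreducible-T
    where
    irreducible-T : Irreducible T x
    irreducible-T {a} {b} 1≤a 1≤b a+b≡x mem-a mem-b with B-mem-elim mem-a | B-mem-elim mem-b
    ... | _ , inj₁ mem-A-a | _ , inj₁ mem-A-b = irreducible 1≤a 1≤b a+b≡x mem-A-a mem-A-b
    ... | _ , inj₂ a≡u     | _                =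
      x≢F+m (irreducible-u+⇒≡F+m irreducible mem-b 1≤b (subst (λ z → z + b ≡ x) a≡u a+b≡x))
    ... | _ , inj₁ _       | _ , inj₂ b≡u     =
      x≢F+m (irreducible-u+⇒≡F+m irreducible mem-a 1≤a
        (trans (+-comm u a) (subst (λ z → a + z ≡ x) b≡u a+b≡x)))

  isMinGen-B-secondGap : isMinGen T u ≡ true
  isMinGen-B-secondGap =
    isMinGen-intro T (B-mem-secondGap u-gap (>⇒≢ m<u)) (gap-positive A u-gap) irreducible
    where
    mem-A : ∀ {y} → mem T y ≡ true → y < u → mem A y ≡ true
    mem-A mem-y y<u with B-mem-elim mem-y
    ... | _ , inj₁ mem-A-y = mem-A-y
    ... | _ , inj₂ y≡u     = contradiction y≡u (<⇒≢ y<u)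
    irreducible : Irreducible T u
    irreducible {a} {b} 1≤a 1≤b a+b≡u mem-a mem-b = mem-gap-≢ A
      (mem-add A a b (mem-A mem-a (subst (a <_) a+b≡u (m<m+n a 1≤b)))
                     (mem-A mem-b (subst (b <_) a+b≡u (m<n+m b 1≤a))))
      u-gap a+b≡u

  isMinGen-B-double-multiplicity : isMinGen T (m + m) ≡ true
  isMinGen-B-double-multiplicity = isMinGen-intro T
    (B-mem-intro (mem-add A m m (multiplicity-mem A) (multiplicity-mem A)) (>⇒≢ m<m+m))
    (≤-trans m-pos (<⇒≤ m<m+m)) irreducible
    where
    m<m+m = m<m+n m m-pos
    irreducible : Irreducible T (m + m)
    irreducible 1≤a 1≤b a+b≡m+m mem-a mem-b = <-irrefl (sym a+b≡m+m)
      (+-mono-< (B-positive⇒>multiplicity mem-a 1≤a) (B-positive⇒>multiplicity mem-b 1≤b))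

  embdim-B : embdim A ≤ embdim T
  embdim-B = subst₂ _≤_ (count-isMinGen A N-A≤L) (count-isMinGen T N-T≤L)
    (count-exchange L isMinGen-B
      (¬≡true⇒≡false λ minGen → mem-gap-≢ A (proj₁ (isMinGen-elim A minGen)) u-gap refl)
      (isMinGen-double-multiplicity A) isMinGen-B-secondGap isMinGen-B-double-multiplicity
      (mem-gap-≢ A (mem-add A m m (multiplicity-mem A) (multiplicity-mem A)) u-gap ∘ sym)
      (<-≤-trans (gap<cond A u-gap) (≤-trans (≤-trans (m≤m+n _ m) (n≤1+n _)) N-A≤L))
      (m≤n⊔m (N-A ⊔ N-T) (suc (m + m))))
    where
    N-A = suc (cond A + m)
    N-T = suc (cond T + multiplicity T)
    L = N-A ⊔ N-T ⊔ suc (m + m)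
    N-A≤L : N-A ≤ L
    N-A≤L = ≤-trans (m≤m⊔n N-A N-T) (m≤m⊔n (N-A ⊔ N-T) (suc (m + m)))
    N-T≤L : N-T ≤ L
    N-T≤L = ≤-trans (m≤n⊔m N-A N-T) (m≤m⊔n (N-A ⊔ N-T) (suc (m + m)))

  wilf-B : sporadic T ≡ sporadic A → Wilf A → Wilf T
  wilf-B n-T≡n-A wilf-A = begin
    frobenius T + 1          ≡⟨ cong (_+ 1) frobenius-B ⟩
    F + 1                    ≤⟨ wilf-A ⟩
    embdim A * sporadic A    ≤⟨ *-monoˡ-≤ (sporadic A) embdim-B ⟩
    embdim T * sporadic A    ≡⟨ cong (embdim T *_) (sym n-T≡n-A) ⟩
    embdim T * sporadic T    ∎
    where open ≤-Reasoning

leaf-induction : ∀ {V : Set} {Vertex P : V → Set} (Child : V → V → Set) (rank : V → ℕ) →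
  (∀ {a t} → Child a t → Vertex a) → (∀ t → Dec (P t)) →
  (∀ {a t} → Child a t → rank a < rank t) →
  (∀ {a t} → Vertex t → Child a t → P a → P t) →
  (∀ t → Vertex t × (∀ a → ¬ Child a t) → P t) →
  ∀ t → Vertex t → P t
leaf-induction {Vertex = Vertex} {P} Child rank child-vertex P? rank-< ascend leaf-P t =
  go t (<-wellFounded (rank t))
  where
  go : ∀ t → Acc _<_ (rank t) → Vertex t → P t
  go t (acc rs) t-vertex with P? t
  ... | yes Pt = Pt
  ... | no ¬Pt = leaf-P t (t-vertex , λ a child →
    ¬Pt (ascend t-vertex child (go a (rs (rank-< child)) (child-vertex child))))

child⇒B-conditions : ∀ {g n A T} → 3 < g → ChildIn g n A T →
  mem A (secondGap A) ≡ false × multiplicity A < secondGap A × secondGap A < frobenius A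
child⇒B-conditions {A = A} 3<g ((genus≡g , _) , ¬ordinary , ¬almostOrdinary , _) =
  proj₁ u-spec , multiplicity<secondGap A 3<genus ¬ordinary ¬almostOrdinary , proj₂ u-spec
  where
  3<genus = subst (3 <_) (sym genus≡g) 3<g
  u-spec = ¬ordinary⇒secondGap-gap A (proj₂ (positive-genus⇒gap A (<-trans z<s 3<genus))) ¬ordinary

corollary6p8 : (g n : ℕ) → 3 < g → 2 ≤ n → n ≤ g →
    (∀ S → LeafIn g n S → Wilf S) →
    ∀ S → InN g n S → Wilf S
corollary6p8 g n 3<g _ _ leaves-wilf =
  leaf-induction {Vertex = InN g n} {Wilf} (ChildIn g n) multiplicity proj₁ wilf?
    (λ {A} {T} → multiplicity-ascends {A} {T}) (λ {A} {T} → wilf-ascends {A} {T}) leaves-wilf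
  where
  wilf? : ∀ S → Dec (Wilf S)
  wilf? S = frobenius S + 1 ≤? embdim S * sporadic S
  multiplicity-ascends : ∀ {A T} → ChildIn g n A T → multiplicity A < multiplicity T
  multiplicity-ascends {A} {T} child@(_ , _ , _ , isB) with child⇒B-conditions {A = A} {T} 3<g child
  ... | u-gap , m<u , u<F = multiplicity<multiplicity-B {A} {T} isB u-gap m<u u<F
  wilf-ascends : ∀ {A T} → InN g n T → ChildIn g n A T → Wilf A → Wilf T
  wilf-ascends {A} {T} (_ , n-T≡n) child@((_ , n-A≡n) , _ , _ , isB)
    with child⇒B-conditions {A = A} {T} 3<g child
  ... | u-gap , m<u , u<F = wilf-B {A} {T} isB u-gap m<u u<F (trans n-T≡n (sym n-A≡n))
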